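{- For every set of formulas $\Gamma$ and formula $\alpha$: $\circ^\#(\mathrm{Var}(\Gamma\cup\{\alpha\})),\Gamma\vdash_{LFI3}\alpha$ if and only if $\Gamma\vdash_{LFI1}\alpha$.
   Context: Formulas are built from propositional variables using unary $\neg,\circ$ and binary $\land,\lor,\to$. Define $\circ^*\alpha:=(\alpha\land\circ\alpha\land\circ\circ\alpha)\lor(\neg\alpha\land\circ\alpha\land\circ\circ\alpha)$ and $\circ^\#\alpha:=\circ^*\alpha\lor(\neg\circ\alpha\land\circ\circ\alpha)$. $\mathrm{Var}(\Delta)$ is the set of variables occurring in $\Delta$ and $\circ^\#(X)=\{\circ^\#p:p\in X\}$. LFI3 is the logic of the 5-valued matrix: with Boolean $\land,\lor,\to,\sim$ on $\{0,1\}$, domain $\{T=(1,0,0),t=(1,0,1),b=(1,1,1),f=(0,1,1),F=(0,1,0)\}$, designated $\{T,t,b\}$, operations $a\dot\land b=(a_1\land b_1,a_2\lor b_2,(\sim a_2\land b_3)\lor(a_3\land\sim b_2)\lor(a_3\land b_3))$, $a\dot\lor b=(a_1\lor b_1,a_2\land b_2,(\sim a_1\land b_3)\lor(a_3\land\sim b_1)\lor(a_3\land b_3))$, $a\dot\to b=(a_1\to b_1,b_2\land(\sim a_2\lor a_3),(\sim a_2\land b_3)\lor(\sim a_2\land a_3\land\sim b_1)\lor(a_3\land b_3)\lor(\sim a_1\land a_3\land\sim b_1))$, $\dot\neg a=(a_2,a_1,a_3)$, $\dot\circ a=(\sim(a_1\land a_2),a_3,a_3\land\sim(a_1\land a_2))$.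 LFI1 is the logic of the 3-valued matrix with domain $\{1,1/2,0\}$, designated $\{1,1/2\}$, $\neg1=0,\neg\frac12=\frac12,\neg0=1$, $\circ1=\circ0=1,\circ\frac12=0$, $\land=\min$, $\lor=\max$, $x\to y=1$ if $x=0$ and $=y$ otherwise. For a matrix, valuations are homomorphisms from formulas and $\Gamma\vdash\alpha$ iff every valuation designating all of $\Gamma$ designates $\alpha$. -}

module Defs where

open import Data.Nat using (ℕ)
open import Data.Bool using (Bool; true; false; _∧_; _∨_; not)
open import Data.Product using (_×_; _,_; ∃; proj₁; proj₂)
open import Data.Sum using (_⊎_)
open import Relation.Binary.PropositionalEquality using (_≡_)

data Formula : Set where
  var  : ℕ → Formula
  ¬'_  : Formula → Formula
  ∘'_  : Formula → Formula
  _∧'_ : Formula → Formula → Formula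
  _∨'_ : Formula → Formula → Formula
  _⇒'_ : Formula → Formula → Formula

∘*_ : Formula → Formula
∘* α = ((α ∧' (∘' α)) ∧' (∘' (∘' α))) ∨' (((¬' α) ∧' (∘' α)) ∧' (∘' (∘' α)))

∘#_ : Formula → Formula
∘# α = (∘* α) ∨' ((¬' (∘' α)) ∧' (∘' (∘' α)))

FSet : Set₁
FSet = Formula → Set

data _occursIn_ (p : ℕ) : Formula → Set where
  here : p occursIn var p
  in¬  : ∀ {φ} → p occursIn φ → p occursIn (¬' φ)
  in∘  : ∀ {φ} → p occursIn φ → p occursIn (∘' φ)
  in∧ˡ : ∀ {φ ψ} → p occursIn φ → p occursIn (φ ∧' ψ)
  in∧ʳ : ∀ {φ ψ} → p occursIn ψ → p occursIn (φ ∧' ψ)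
  in∨ˡ : ∀ {φ ψ} → p occursIn φ → p occursIn (φ ∨' ψ)
  in∨ʳ : ∀ {φ ψ} → p occursIn ψ → p occursIn (φ ∨' ψ)
  in⇒ˡ : ∀ {φ ψ} → p occursIn φ → p occursIn (φ ⇒' ψ)
  in⇒ʳ : ∀ {φ ψ} → p occursIn ψ → p occursIn (φ ⇒' ψ)

Var : FSet → ℕ → Set
Var Δ p = ∃ λ φ → Δ φ × p occursIn φ

_∪｛_｝ : FSet → Formula → FSet
(Γ ∪｛ α ｝) φ = Γ φ ⊎ φ ≡ α

∘#Set : (ℕ → Set) → FSet
∘#Set X φ = ∃ λ p → X p × φ ≡ ∘# (var p)

_∪_ : FSet → FSet → FSet
(A ∪ B) φ = A φ ⊎ B φ

-- LFI3: 5-valued matrix on triples of Booleans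

V5 : Set
V5 = Bool × Bool × Bool

π₁ π₂ π₃ : V5 → Bool
π₁ (x , _ , _) = x
π₂ (_ , y , _) = y
π₃ (_ , _ , z) = z

_⊃_ : Bool → Bool → Bool
x ⊃ y = not x ∨ y

T5 t5 b5 f5 F5 : V5
T5 = true , false , false
t5 = true , false , true
b5 = true , true , true
f5 = false , true , true
F5 = false , true , false

InDom5 : V5 → Set
InDom5 a = a ≡ T5 ⊎ a ≡ t5 ⊎ a ≡ b5 ⊎ a ≡ f5 ⊎ a ≡ F5

Des5 : V5 → Set
Des5 a = a ≡ T5 ⊎ a ≡ t5 ⊎ a ≡ b5

and5 : V5 → V5 → V5
and5 a b = (π₁ a ∧ π₁ b) , (π₂ a ∨ π₂ b) ,
  ((not (π₂ a) ∧ π₃ b) ∨ (π₃ a ∧ not (π₂ b)) ∨ (π₃ a ∧ π₃ b))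

or5 : V5 → V5 → V5
or5 a b = (π₁ a ∨ π₁ b) , (π₂ a ∧ π₂ b) ,
  ((not (π₁ a) ∧ π₃ b) ∨ (π₃ a ∧ not (π₁ b)) ∨ (π₃ a ∧ π₃ b))

imp5 : V5 → V5 → V5
imp5 a b = (π₁ a ⊃ π₁ b) , (π₂ b ∧ (not (π₂ a) ∨ π₃ a)) ,
  ((not (π₂ a) ∧ π₃ b) ∨ (not (π₂ a) ∧ π₃ a ∧ not (π₁ b)) ∨ (π₃ a ∧ π₃ b)
    ∨ (not (π₁ a) ∧ π₃ a ∧ not (π₁ b)))

neg5 : V5 → V5
neg5 a = π₂ a , π₁ a , π₃ a

circ5 : V5 → V5
circ5 a = not (π₁ a ∧ π₂ a) , π₃ a , (π₃ a ∧ not (π₁ a ∧ π₂ a))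

eval5 : (ℕ → V5) → Formula → V5
eval5 v (var p)  = v p
eval5 v (¬' φ)   = neg5 (eval5 v φ)
eval5 v (∘' φ)   = circ5 (eval5 v φ)
eval5 v (φ ∧' ψ) = and5 (eval5 v φ) (eval5 v ψ)
eval5 v (φ ∨' ψ) = or5 (eval5 v φ) (eval5 v ψ)
eval5 v (φ ⇒' ψ) = imp5 (eval5 v φ) (eval5 v ψ)

_⊢LFI3_ : FSet → Formula → Set
Γ ⊢LFI3 α = (v : ℕ → V5) → (∀ p → InDom5 (v p)) →
  (∀ φ → Γ φ → Des5 (eval5 v φ)) → Des5 (eval5 v α)

data V3 : Set where
  one half zero : V3

Des3 : V3 → Set
Des3 a = a ≡ one ⊎ a ≡ half

neg3 : V3 → V3
neg3 one  = zero
neg3 half = half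
neg3 zero = one

circ3 : V3 → V3
circ3 one  = one
circ3 half = zero
circ3 zero = one

min3 : V3 → V3 → V3
min3 zero _    = zero
min3 _    zero = zero
min3 half _    = half
min3 _    half = half
min3 one  one  = one

max3 : V3 → V3 → V3
max3 one  _    = one
max3 _    one  = one
max3 half _    = half
max3 _    half = half
max3 zero zero = zero

imp3 : V3 → V3 → V3
imp3 zero _ = one
imp3 _    y = y

eval3 : (ℕ → V3) → Formula → V3
eval3 v (var p)  = v p
eval3 v (¬' φ)   = neg3 (eval3 v φ)
eval3 v (∘' φ)   = circ3 (eval3 v φ)
eval3 v (φ ∧' ψ) = min3 (eval3 v φ) (eval3 v ψ)
eval3 v (φ ∨' ψ) = max3 (eval3 v φ) (eval3 v ψ)
eval3 v (φ ⇒' ψ) = imp3 (eval3 v φ) (eval3 v ψ)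

_⊢LFI1_ : FSet → Formula → Set
Γ ⊢LFI1 α = (v : ℕ → V3) → (∀ φ → Γ φ → Des3 (eval3 v φ)) → Des3 (eval3 v α)

{-# OPTIONS --safe #-}
-- LFI1 is the submatrix of LFI3 on {T, b, F}: the embedding 1 ↦ T, ½ ↦ b, 0 ↦ F commutes
-- with all connectives and preserves and reflects designation. The formula ∘# p is designated
-- exactly when p takes one of these three values, so an LFI3-valuation designating
-- ∘#(Var(Γ ∪ {α})) is, on the variables that matter, an LFI1-valuation in disguise.
module Submission where

open import Defs
open import Data.Bool using (true; false)
open import Data.Empty using (⊥-elim)
open import Data.Product using (_×_; _,_)
open import Data.Sum using (inj₁; inj₂)
open import Function using (_∘_)
open import Relation.Nullary using (¬_)
open import Relation.Binary.PropositionalEquality using (_≡_; refl; sym; trans; cong; cong₂; subst)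

embed : V3 → V5
embed one  = T5
embed half = b5
embed zero = F5

retract : V5 → V3
retract (true  , false , _) = one
retract (true  , true  , _) = half
retract (false , _     , _) = zero

embed-InDom5 : ∀ x → InDom5 (embed x)
embed-InDom5 one  = inj₁ refl
embed-InDom5 half = inj₂ (inj₂ (inj₁ refl))
embed-InDom5 zero = inj₂ (inj₂ (inj₂ (inj₂ refl)))

¬Des5-F5 : ¬ Des5 F5
¬Des5-F5 (inj₁ ())
¬Des5-F5 (inj₂ (inj₁ ()))
¬Des5-F5 (inj₂ (inj₂ ()))

embed-preserves-Des : ∀ x → Des3 x → Des5 (embed x)
embed-preserves-Des one  _ = inj₁ refl
embed-preserves-Des half _ = inj₂ (inj₂ refl)
embed-preserves-Des zero (inj₁ ())
embed-preserves-Des zero (inj₂ ())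

embed-reflects-Des : ∀ x → Des5 (embed x) → Des3 x
embed-reflects-Des one  _ = inj₁ refl
embed-reflects-Des half _ = inj₂ refl
embed-reflects-Des zero d = ⊥-elim (¬Des5-F5 d)

embed-¬ : ∀ x → neg5 (embed x) ≡ embed (neg3 x)
embed-¬ one  = refl
embed-¬ half = refl
embed-¬ zero = refl

embed-∘ : ∀ x → circ5 (embed x) ≡ embed (circ3 x)
embed-∘ one  = refl
embed-∘ half = refl
embed-∘ zero = refl

embed-∧ : ∀ x y → and5 (embed x) (embed y) ≡ embed (min3 x y)
embed-∧ one  one  = refl
embed-∧ one  half = refl
embed-∧ one  zero = refl
embed-∧ half one  = refl
embed-∧ half half = refl
embed-∧ half zero = refl
embed-∧ zero one  = refl
embed-∧ zero half = refl
embed-∧ zero zero = refl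

embed-∨ : ∀ x y → or5 (embed x) (embed y) ≡ embed (max3 x y)
embed-∨ one  one  = refl
embed-∨ one  half = refl
embed-∨ one  zero = refl
embed-∨ half one  = refl
embed-∨ half half = refl
embed-∨ half zero = refl
embed-∨ zero one  = refl
embed-∨ zero half = refl
embed-∨ zero zero = refl

embed-⇒ : ∀ x y → imp5 (embed x) (embed y) ≡ embed (imp3 x y)
embed-⇒ one  one  = refl
embed-⇒ one  half = refl
embed-⇒ one  zero = refl
embed-⇒ half one  = refl
embed-⇒ half half = refl
embed-⇒ half zero = refl
embed-⇒ zero one  = refl
embed-⇒ zero half = refl
embed-⇒ zero zero = refl

eval5-embed : ∀ v φ → eval5 (embed ∘ v) φ ≡ embed (eval3 v φ)
eval5-embed v (var p)  = refl
eval5-embed v (¬' φ)   = trans (cong neg5 (eval5-embed v φ)) (embed-¬ (eval3 v φ))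
eval5-embed v (∘' φ)   = trans (cong circ5 (eval5-embed v φ)) (embed-∘ (eval3 v φ))
eval5-embed v (φ ∧' ψ) =
  trans (cong₂ and5 (eval5-embed v φ) (eval5-embed v ψ))
        (embed-∧ (eval3 v φ) (eval3 v ψ))
eval5-embed v (φ ∨' ψ) =
  trans (cong₂ or5 (eval5-embed v φ) (eval5-embed v ψ))
        (embed-∨ (eval3 v φ) (eval3 v ψ))
eval5-embed v (φ ⇒' ψ) =
  trans (cong₂ imp5 (eval5-embed v φ) (eval5-embed v ψ))
        (embed-⇒ (eval3 v φ) (eval3 v ψ))

eval5-local : ∀ v w φ → (∀ p → p occursIn φ → v p ≡ w p) → eval5 v φ ≡ eval5 w φ
eval5-local v w (var p)  h = h p here
eval5-local v w (¬' φ)   h = cong neg5 (eval5-local v w φ (λ p → h p ∘ in¬))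
eval5-local v w (∘' φ)   h = cong circ5 (eval5-local v w φ (λ p → h p ∘ in∘))
eval5-local v w (φ ∧' ψ) h =
  cong₂ and5 (eval5-local v w φ (λ p → h p ∘ in∧ˡ)) (eval5-local v w ψ (λ p → h p ∘ in∧ʳ))
eval5-local v w (φ ∨' ψ) h =
  cong₂ or5 (eval5-local v w φ (λ p → h p ∘ in∨ˡ)) (eval5-local v w ψ (λ p → h p ∘ in∨ʳ))
eval5-local v w (φ ⇒' ψ) h =
  cong₂ imp5 (eval5-local v w φ (λ p → h p ∘ in⇒ˡ)) (eval5-local v w ψ (λ p → h p ∘ in⇒ʳ))

eval5-retract : ∀ v φ → (∀ p → p occursIn φ → embed (retract (v p)) ≡ v p) →
  eval5 v φ ≡ embed (eval3 (retract ∘ v) φ)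
eval5-retract v φ h =
  trans (eval5-local v (embed ∘ retract ∘ v) φ (λ p → sym ∘ h p)) (eval5-embed (retract ∘ v) φ)

-- Definitionally, eval5 v (∘# φ) ≡ ∘#₅ (eval5 v φ).
∘#₅ : V5 → V5
∘#₅ x = eval5 (λ _ → x) (∘# var 0)

∘#₅-embed-Des : ∀ x → Des5 (∘#₅ (embed x))
∘#₅-embed-Des one  = inj₁ refl
∘#₅-embed-Des half = inj₁ refl
∘#₅-embed-Des zero = inj₁ refl

-- At t and f, ∘# evaluates to F.
∘#₅-Des⇒embed-retract : ∀ x → InDom5 x → Des5 (∘#₅ x) → embed (retract x) ≡ x
∘#₅-Des⇒embed-retract _ (inj₁ refl)                      _ = refl
∘#₅-Des⇒embed-retract _ (inj₂ (inj₁ refl))               d = ⊥-elim (¬Des5-F5 d)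
∘#₅-Des⇒embed-retract _ (inj₂ (inj₂ (inj₁ refl)))        _ = refl
∘#₅-Des⇒embed-retract _ (inj₂ (inj₂ (inj₂ (inj₁ refl)))) d = ⊥-elim (¬Des5-F5 d)
∘#₅-Des⇒embed-retract _ (inj₂ (inj₂ (inj₂ (inj₂ refl)))) _ = refl

LFI3-∘#⇒LFI1 : ∀ Γ α → (∘#Set (Var (Γ ∪｛ α ｝)) ∪ Γ) ⊢LFI3 α → Γ ⊢LFI1 α
LFI3-∘#⇒LFI1 Γ α ⊢α v ⊨Γ =
  embed-reflects-Des _ (subst Des5 (eval5-embed v α) (⊢α (embed ∘ v) (embed-InDom5 ∘ v) ⊨prem))
  where
  ⊨prem : ∀ φ → (∘#Set (Var (Γ ∪｛ α ｝)) ∪ Γ) φ → Des5 (eval5 (embed ∘ v) φ)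
  ⊨prem _ (inj₁ (p , _ , refl)) = ∘#₅-embed-Des (v p)
  ⊨prem φ (inj₂ φ∈Γ) =
    subst Des5 (sym (eval5-embed v φ)) (embed-preserves-Des _ (⊨Γ φ φ∈Γ))

LFI1⇒LFI3-∘# : ∀ Γ α → Γ ⊢LFI1 α → (∘#Set (Var (Γ ∪｛ α ｝)) ∪ Γ) ⊢LFI3 α
LFI1⇒LFI3-∘# Γ α ⊢α v v∈Dom ⊨prem =
  subst Des5 (sym (eval5-retract-on (inj₂ refl)))
    (embed-preserves-Des _ (⊢α (retract ∘ v) ⊨Γ))
  where
  eval5-retract-on : ∀ {φ} → (Γ ∪｛ α ｝) φ → eval5 v φ ≡ embed (eval3 (retract ∘ v) φ)
  eval5-retract-on {φ} φ∈ = eval5-retract v φ λ p p∈φ →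
    ∘#₅-Des⇒embed-retract (v p) (v∈Dom p) (⊨prem (∘# var p) (inj₁ (p , (φ , φ∈ , p∈φ) , refl)))

  ⊨Γ : ∀ φ → Γ φ → Des3 (eval3 (retract ∘ v) φ)
  ⊨Γ φ φ∈Γ =
    embed-reflects-Des _ (subst Des5 (eval5-retract-on (inj₁ φ∈Γ)) (⊨prem φ (inj₂ φ∈Γ)))

theorem20 : (Γ : FSet) (α : Formula) →
    ((∘#Set (Var (Γ ∪｛ α ｝)) ∪ Γ) ⊢LFI3 α → Γ ⊢LFI1 α) × (Γ ⊢LFI1 α → (∘#Set (Var (Γ ∪｛ α ｝)) ∪ Γ) ⊢LFI3 α)
theorem20 Γ α = LFI3-∘#⇒LFI1 Γ α , LFI1⇒LFI3-∘# Γ α
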